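{- For all $m,n\in\mathbb{N}$, $h_2(mn)\ge h_2(m)+h_2(n)$.
   Context: For $n\in\mathbb{N}$, let $\sigma:\mathbb{F}_2^n\to\mathbb{F}_2^n$ be the cyclic shift $\sigma(\sum_{i=0}^{n-1}x_ie_i)=\sum_{i=0}^{n-1}x_ie_{i+1}$ (indices mod $n$). A subspace $U\le\mathbb{F}_2^n$ is cyclically covering if $\bigcup_{i=0}^{n-1}\sigma^i(U)=\mathbb{F}_2^n$. $h_2(n)$ denotes the largest possible codimension of a cyclically covering subspace of $\mathbb{F}_2^n$. -}

module Defs where

open import Data.Bool using (Bool; true; false; _xor_; if_then_else_)
open import Data.Nat using (ℕ; zero; suc; _∸_; _≤_; _<_)
open import Data.Vec using (Vec; []; _∷_; replicate; zipWith; last; init)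
open import Data.Product using (Σ; ∃; _×_; _,_)
open import Relation.Binary.PropositionalEquality using (_≡_)

-- Vectors of F₂ⁿ, with F₂ represented by Bool (addition = xor).
F2^ : ℕ → Set
F2^ n = Vec Bool n

zeroV : ∀ {n} → F2^ n
zeroV {n} = replicate n false

_⊕_ : ∀ {n} → F2^ n → F2^ n → F2^ n
_⊕_ = zipWith _xor_

-- Cyclic shift σ(Σ xᵢ eᵢ) = Σ xᵢ e_{i+1}: coordinate i moves to i+1 (mod n),
-- i.e. (σ x)₀ = x_{n-1} and (σ x)_{j+1} = x_j.
σ : ∀ {n} → F2^ n → F2^ n
σ {zero} [] = []
σ {suc n} xs = last xs ∷ init xs

σ^ : ∀ {n} → ℕ → F2^ n → F2^ n
σ^ zero x = x
σ^ (suc i) x = σ (σ^ i x)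

-- A linear subspace of F₂ⁿ (over F₂ scalar multiplication is trivial, so
-- closure under 0 and + is the subspace condition).
record Subspace (n : ℕ) : Set₁ where
  field
    _∈U : F2^ n → Set
    zero∈ : zeroV ∈U
    ⊕∈ : ∀ {x y} → x ∈U → y ∈U → (x ⊕ y) ∈U
open Subspace public

lincomb : ∀ {n d} → Vec (F2^ n) d → Vec Bool d → F2^ n
lincomb [] [] = zeroV
lincomb (b ∷ bs) (c ∷ cs) = if c then (b ⊕ lincomb bs cs) else lincomb bs cs

AllIn : ∀ {n d} → Subspace n → Vec (F2^ n) d → Set
AllIn U [] = Data.Unit.⊤ where import Data.Unit
AllIn U (b ∷ bs) = (_∈U U b) × AllIn U bs

IsBasis : ∀ {n d} → Subspace n → Vec (F2^ n) d → Set
IsBasis {n} {d} U bs =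
  AllIn U bs
  × (∀ (cs : Vec Bool d) → lincomb bs cs ≡ zeroV → cs ≡ replicate d false)
  × (∀ (v : F2^ n) → _∈U U v → Σ (Vec Bool d) λ cs → lincomb bs cs ≡ v)

HasDim : ∀ {n} → Subspace n → ℕ → Set
HasDim {n} U d = Σ (Vec (F2^ n) d) λ bs → IsBasis U bs

HasCodim : ∀ {n} → Subspace n → ℕ → Set
HasCodim {n} U c = c ≤ n × HasDim U (n ∸ c)

CyclicallyCovering : ∀ {n} → Subspace n → Set
CyclicallyCovering {n} U =
  ∀ (v : F2^ n) → Σ ℕ λ i → i < n × Σ (F2^ n) λ u → _∈U U u × σ^ i u ≡ v

-- IsH2 n h : h = h₂(n), the largest codimension of a cyclically covering
-- subspace of F₂ⁿ (attained, and an upper bound for all such subspaces).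
IsH2 : ℕ → ℕ → Set₁
IsH2 n h =
  (Σ (Subspace n) λ U → CyclicallyCovering U × HasCodim U h)
  × (∀ (U : Subspace n) (c : ℕ) → CyclicallyCovering U → HasCodim U c → c ≤ h)

module Submission where

-- Let U ≤ F₂ᵐ, W ≤ F₂ⁿ be cyclically covering of codimensions h₂(m), h₂(n).
-- Read a word y of length mn as m blocks of length n; heads y ∈ F₂ᵐ lists the
-- first entries of the blocks and sumOfBlocks y ∈ F₂ⁿ is their sum.  The block
-- sum commutes with σ and heads ∘ σⁿ = σ ∘ heads, so every word can be shifted
-- into S = {y : heads y ∈ U, sumOfBlocks y ∈ W}, and every subspace containing
-- S is cyclically covering.  As U covers e₀, some basis vector u of U has odd
-- parity; with it we write down (dim U − 1) + dim W + (m−1)(n−1) =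
-- mn − h₂(m) − h₂(n) words whose span contains S.  A span of k words has a
-- basis of at most k words (discard dependent ones), so its codimension is at
-- least mn − k, and maximality of h₂(mn) concludes.

open import Defs
open import Data.Nat using (ℕ; _+_; _*_; _≤_)
open import Data.Nat using (zero; suc; _∸_; _<_; z≤n; s≤s)
open import Data.Nat.Properties using (≤-refl; ≤-trans; n≤1+n; ∸-monoʳ-≤; m∸n≤m; m∸[m∸n]≡n; m∸n+n≡m; <⇒≤; m≤m+n; m+n∸m≡n)
open import Data.Nat.Tactic.RingSolver using (solve-∀)
open import Data.Nat.DivMod using (_%_; _/_; m%n<n; m≡m%n+[m/n]*n)
open import Data.Bool using (Bool; true; false; _xor_; if_then_else_)
open import Data.Bool.Properties using (xor-assoc; xor-comm; xor-same; xor-identityʳ) renaming (_≟_ to _≟ᵇ_)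
open import Data.Vec using (Vec; []; _∷_; replicate; zipWith; map; lookup; removeAt; insertAt; _++_; concat; head; tail; last; init; _∷ʳ_; toList; group; initLast)
open import Data.Vec.Properties using (≡-dec; zipWith-assoc; zipWith-comm; zipWith-identityˡ; removeAt-insertAt; insertAt-lookup; lookup-map; toList-∷ʳ; toList-++; last-∷ʳ; init-∷ʳ; map-∷ʳ; length-toList; ++-injective)
open import Data.List as List using (List)
import Data.List.Properties as List
open import Data.Fin using (Fin)
open import Data.Product using (Σ; _×_; _,_; proj₁; proj₂)
open import Data.Sum using (_⊎_; inj₁; inj₂)
open import Data.Empty using (⊥-elim)
open import Data.Unit using (tt)
open import Relation.Nullary using (¬_; Dec; yes; no; ¬?; _×-dec_)
open import Relation.Binary.Definitions using (DecidableEquality)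
open import Relation.Binary.PropositionalEquality using (_≡_; refl; sym; trans; cong; cong₂; subst; module ≡-Reasoning)

-- An F₂-vector space: a commutative monoid in which every element is its
-- own inverse.  Over F₂ the scalars 0 and 1 act trivially, so nothing else
-- is needed.
record F₂Space : Set₁ where
  infixl 6 _⊞_
  field
    Carrier     : Set
    _⊞_         : Carrier → Carrier → Carrier
    0#          : Carrier
    ⊞-assoc     : ∀ x y z → (x ⊞ y) ⊞ z ≡ x ⊞ (y ⊞ z)
    ⊞-comm      : ∀ x y → x ⊞ y ≡ y ⊞ x
    ⊞-identityˡ : ∀ x → 0# ⊞ x ≡ x
    ⊞-self      : ∀ x → x ⊞ x ≡ 0#

module F₂SpaceTheory (S : F₂Space) where
  open F₂Space S
  open ≡-Reasoning

  ⊞-identityʳ : ∀ x → x ⊞ 0# ≡ x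
  ⊞-identityʳ x = trans (⊞-comm x 0#) (⊞-identityˡ x)

  ⊞-cancelˡ : ∀ x y → x ⊞ (x ⊞ y) ≡ y
  ⊞-cancelˡ x y = begin
    x ⊞ (x ⊞ y) ≡⟨ sym (⊞-assoc x x y) ⟩
    (x ⊞ x) ⊞ y ≡⟨ cong (_⊞ y) (⊞-self x) ⟩
    0# ⊞ y      ≡⟨ ⊞-identityˡ y ⟩
    y           ∎

  ⊞-cancelʳ : ∀ x y → (x ⊞ y) ⊞ y ≡ x
  ⊞-cancelʳ x y = trans (⊞-assoc x y y) (trans (cong (x ⊞_) (⊞-self y)) (⊞-identityʳ x))

  ⊞≡0⇒≡ : ∀ x y → x ⊞ y ≡ 0# → x ≡ y
  ⊞≡0⇒≡ x y e = trans (sym (⊞-cancelʳ x y)) (trans (cong (_⊞ y) e) (⊞-identityˡ y))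

  ⊞-lcomm : ∀ x y z → x ⊞ (y ⊞ z) ≡ y ⊞ (x ⊞ z)
  ⊞-lcomm x y z = begin
    x ⊞ (y ⊞ z) ≡⟨ sym (⊞-assoc x y z) ⟩
    (x ⊞ y) ⊞ z ≡⟨ cong (_⊞ z) (⊞-comm x y) ⟩
    (y ⊞ x) ⊞ z ≡⟨ ⊞-assoc y x z ⟩
    y ⊞ (x ⊞ z) ∎

  ⊞-interchange : ∀ a b c d → (a ⊞ b) ⊞ (c ⊞ d) ≡ (a ⊞ c) ⊞ (b ⊞ d)
  ⊞-interchange a b c d = begin
    (a ⊞ b) ⊞ (c ⊞ d) ≡⟨ ⊞-assoc a b (c ⊞ d) ⟩
    a ⊞ (b ⊞ (c ⊞ d)) ≡⟨ cong (a ⊞_) (⊞-lcomm b c d) ⟩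
    a ⊞ (c ⊞ (b ⊞ d)) ≡⟨ sym (⊞-assoc a c (b ⊞ d)) ⟩
    (a ⊞ c) ⊞ (b ⊞ d) ∎

  scale : Bool → Carrier → Carrier
  scale true  x = x
  scale false x = 0#

  scale-0 : ∀ c → scale c 0# ≡ 0#
  scale-0 true  = refl
  scale-0 false = refl

  scale-xor : ∀ a c x → scale (a xor c) x ≡ scale a x ⊞ scale c x
  scale-xor true  true  x = sym (⊞-self x)
  scale-xor true  false x = sym (⊞-identityʳ x)
  scale-xor false c     x = sym (⊞-identityˡ _)

  lc : ∀ {d} → Vec Carrier d → Vec Bool d → Carrier
  lc []       []       = 0#
  lc (b ∷ bs) (c ∷ cs) = if c then b ⊞ lc bs cs else lc bs cs

  lc-∷ : ∀ {d} b (bs : Vec Carrier d) c cs → lc (b ∷ bs) (c ∷ cs) ≡ scale c b ⊞ lc bs cs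
  lc-∷ b bs true  cs = refl
  lc-∷ b bs false cs = sym (⊞-identityˡ _)

  lc-zero : ∀ {d} (bs : Vec Carrier d) → lc bs (replicate d false) ≡ 0#
  lc-zero []       = refl
  lc-zero (b ∷ bs) = lc-zero bs

  lc-xor : ∀ {d} (bs : Vec Carrier d) cs ds → lc bs (zipWith _xor_ cs ds) ≡ lc bs cs ⊞ lc bs ds
  lc-xor []       []       []       = sym (⊞-identityˡ 0#)
  lc-xor (b ∷ bs) (c ∷ cs) (d ∷ ds) = begin
    lc (b ∷ bs) ((c xor d) ∷ zipWith _xor_ cs ds)     ≡⟨ lc-∷ b bs (c xor d) _ ⟩
    scale (c xor d) b ⊞ lc bs (zipWith _xor_ cs ds)   ≡⟨ cong₂ _⊞_ (scale-xor c d b) (lc-xor bs cs ds) ⟩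
    (scale c b ⊞ scale d b) ⊞ (lc bs cs ⊞ lc bs ds)   ≡⟨ ⊞-interchange _ _ _ _ ⟩
    (scale c b ⊞ lc bs cs) ⊞ (scale d b ⊞ lc bs ds)   ≡⟨ sym (cong₂ _⊞_ (lc-∷ b bs c cs) (lc-∷ b bs d ds)) ⟩
    lc (b ∷ bs) (c ∷ cs) ⊞ lc (b ∷ bs) (d ∷ ds)       ∎

  lc-++ : ∀ {d e} (bs : Vec Carrier d) (bs′ : Vec Carrier e) cs cs′ →
          lc (bs ++ bs′) (cs ++ cs′) ≡ lc bs cs ⊞ lc bs′ cs′
  lc-++ []       bs′ []       cs′ = sym (⊞-identityˡ _)
  lc-++ (b ∷ bs) bs′ (c ∷ cs) cs′ = begin
    lc (b ∷ (bs ++ bs′)) (c ∷ (cs ++ cs′)) ≡⟨ lc-∷ b (bs ++ bs′) c (cs ++ cs′) ⟩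
    scale c b ⊞ lc (bs ++ bs′) (cs ++ cs′) ≡⟨ cong (scale c b ⊞_) (lc-++ bs bs′ cs cs′) ⟩
    scale c b ⊞ (lc bs cs ⊞ lc bs′ cs′)    ≡⟨ sym (⊞-assoc _ _ _) ⟩
    (scale c b ⊞ lc bs cs) ⊞ lc bs′ cs′    ≡⟨ cong (_⊞ lc bs′ cs′) (sym (lc-∷ b bs c cs)) ⟩
    lc (b ∷ bs) (c ∷ cs) ⊞ lc bs′ cs′      ∎

  lc-removeAt : ∀ {d} (bs : Vec Carrier (suc d)) cs (j : Fin (suc d)) →
    lc bs cs ≡ scale (lookup cs j) (lookup bs j) ⊞ lc (removeAt bs j) (removeAt cs j)
  lc-removeAt (b ∷ bs)      (c ∷ cs)      Fin.zero    = lc-∷ b bs c cs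
  lc-removeAt (b ∷ b′ ∷ bs) (c ∷ c′ ∷ cs) (Fin.suc j) = begin
    lc (b ∷ b′ ∷ bs) (c ∷ c′ ∷ cs)      ≡⟨ lc-∷ b (b′ ∷ bs) c (c′ ∷ cs) ⟩
    scale c b ⊞ lc (b′ ∷ bs) (c′ ∷ cs)  ≡⟨ cong (scale c b ⊞_) (lc-removeAt (b′ ∷ bs) (c′ ∷ cs) j) ⟩
    scale c b ⊞ (t ⊞ lc rest crest)     ≡⟨ ⊞-lcomm _ _ _ ⟩
    t ⊞ (scale c b ⊞ lc rest crest)     ≡⟨ cong (t ⊞_) (sym (lc-∷ b rest c crest)) ⟩
    t ⊞ lc (b ∷ rest) (c ∷ crest)       ∎
    where
    t     = scale (lookup (c′ ∷ cs) j) (lookup (b′ ∷ bs) j)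
    rest  = removeAt (b′ ∷ bs) j
    crest = removeAt (c′ ∷ cs) j

  InSpan : ∀ {d} → Vec Carrier d → Carrier → Set
  InSpan {d} bs x = Σ (Vec Bool d) λ cs → lc bs cs ≡ x

  span-0 : ∀ {d} (bs : Vec Carrier d) → InSpan bs 0#
  span-0 bs = replicate _ false , lc-zero bs

  span-⊞ : ∀ {d} (bs : Vec Carrier d) {x y} → InSpan bs x → InSpan bs y → InSpan bs (x ⊞ y)
  span-⊞ bs (cs , p) (ds , q) = zipWith _xor_ cs ds , trans (lc-xor bs cs ds) (cong₂ _⊞_ p q)

  span-++ : ∀ {d e} (bs : Vec Carrier d) (bs′ : Vec Carrier e) {x y} →
            InSpan bs x → InSpan bs′ y → InSpan (bs ++ bs′) (x ⊞ y)
  span-++ bs bs′ (cs , p) (ds , q) = cs ++ ds , trans (lc-++ bs bs′ cs ds) (cong₂ _⊞_ p q)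

  span-head : ∀ {d} b (bs : Vec Carrier d) → InSpan (b ∷ bs) b
  span-head b bs = true ∷ replicate _ false , trans (cong (b ⊞_) (lc-zero bs)) (⊞-identityʳ b)

  span-tail : ∀ {d} b (bs : Vec Carrier d) {x} → InSpan bs x → InSpan (b ∷ bs) x
  span-tail b bs (cs , p) = false ∷ cs , p

  span-removeAt⊆ : ∀ {d} (bs : Vec Carrier (suc d)) j {x} → InSpan (removeAt bs j) x → InSpan bs x
  span-removeAt⊆ bs j (ds , p) = insertAt ds j false , (begin
    lc bs (insertAt ds j false)
      ≡⟨ lc-removeAt bs (insertAt ds j false) j ⟩
    scale (lookup (insertAt ds j false) j) (lookup bs j) ⊞ lc (removeAt bs j) (removeAt (insertAt ds j false) j)
      ≡⟨ cong₂ (λ c r → scale c (lookup bs j) ⊞ lc (removeAt bs j) r) (insertAt-lookup ds j false) (removeAt-insertAt ds j false) ⟩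
    0# ⊞ lc (removeAt bs j) ds
      ≡⟨ ⊞-identityˡ _ ⟩
    lc (removeAt bs j) ds
      ≡⟨ p ⟩
    _ ∎)

  span⊆removeAt : ∀ {d} (bs : Vec Carrier (suc d)) j → InSpan (removeAt bs j) (lookup bs j) →
                  ∀ {x} → InSpan bs x → InSpan (removeAt bs j) x
  span⊆removeAt bs j bⱼ∈rest (ds , p) =
    subst (InSpan (removeAt bs j)) (trans (sym (lc-removeAt bs ds j)) p) (split (lookup ds j))
    where
    split : ∀ c → InSpan (removeAt bs j) (scale c (lookup bs j) ⊞ lc (removeAt bs j) (removeAt ds j))
    split true  = span-⊞ (removeAt bs j) bⱼ∈rest (removeAt ds j , refl)
    split false = subst (InSpan (removeAt bs j)) (sym (⊞-identityˡ _)) (removeAt ds j , refl)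

  dependent∈span : ∀ {d} (bs : Vec Carrier (suc d)) cs j → lc bs cs ≡ 0# → lookup cs j ≡ true →
                   InSpan (removeAt bs j) (lookup bs j)
  dependent∈span bs cs j rel cⱼ = removeAt cs j , sym (⊞≡0⇒≡ (lookup bs j) _
    (trans (cong (λ c → scale c (lookup bs j) ⊞ lc (removeAt bs j) (removeAt cs j)) (sym cⱼ))
           (trans (sym (lc-removeAt bs cs j)) rel)))

-- F₂-linear maps.  Preservation of 0 follows from additivity.
record Linear (S T : F₂Space) : Set where
  private
    module S = F₂Space S
    module T = F₂Space T
  field
    apply   : S.Carrier → T.Carrier
    apply-⊞ : ∀ x y → apply (x S.⊞ y) ≡ apply x T.⊞ apply y
open Linear public

module _ {S T : F₂Space} (f : Linear S T) where
  private
    module S = F₂Space S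
    module T = F₂Space T
    module SL = F₂SpaceTheory S
    module TL = F₂SpaceTheory T

  apply-0 : apply f S.0# ≡ T.0#
  apply-0 = begin
    apply f S.0#                      ≡⟨ cong (apply f) (sym (S.⊞-self S.0#)) ⟩
    apply f (S.0# S.⊞ S.0#)           ≡⟨ apply-⊞ f S.0# S.0# ⟩
    apply f S.0# T.⊞ apply f S.0#     ≡⟨ T.⊞-self _ ⟩
    T.0#                              ∎
    where open ≡-Reasoning

  apply-scale : ∀ c x → apply f (SL.scale c x) ≡ TL.scale c (apply f x)
  apply-scale true  x = refl
  apply-scale false x = apply-0

  lc-map : ∀ {d} (bs : Vec S.Carrier d) cs → TL.lc (map (apply f) bs) cs ≡ apply f (SL.lc bs cs)
  lc-map []       []       = sym apply-0
  lc-map (b ∷ bs) (c ∷ cs) = begin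
    TL.lc (apply f b ∷ map (apply f) bs) (c ∷ cs)        ≡⟨ TL.lc-∷ (apply f b) (map (apply f) bs) c cs ⟩
    TL.scale c (apply f b) T.⊞ TL.lc (map (apply f) bs) cs ≡⟨ cong₂ T._⊞_ (sym (apply-scale c b)) (lc-map bs cs) ⟩
    apply f (SL.scale c b) T.⊞ apply f (SL.lc bs cs)     ≡⟨ sym (apply-⊞ f _ _) ⟩
    apply f (SL.scale c b S.⊞ SL.lc bs cs)               ≡⟨ cong (apply f) (sym (SL.lc-∷ b bs c cs)) ⟩
    apply f (SL.lc (b ∷ bs) (c ∷ cs))                    ∎
    where open ≡-Reasoning

  span-map : ∀ {d} (bs : Vec S.Carrier d) {x} → SL.InSpan bs x → TL.InSpan (map (apply f) bs) (apply f x)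
  span-map bs (cs , p) = cs , trans (lc-map bs cs) (cong (apply f) p)

idₗ : ∀ {S} → Linear S S
idₗ = record { apply = λ x → x ; apply-⊞ = λ x y → refl }

_∘ₗ_ : ∀ {S T R} → Linear T R → Linear S T → Linear S R
g ∘ₗ f = record { apply = λ x → apply g (apply f x)
                ; apply-⊞ = λ x y → trans (cong (apply g) (apply-⊞ f x y)) (apply-⊞ g _ _) }

_+ₗ_ : ∀ {S T} → Linear S T → Linear S T → Linear S T
_+ₗ_ {T = T} f g = record
  { apply   = λ x → apply f x ⊞ apply g x
  ; apply-⊞ = λ x y → trans (cong₂ _⊞_ (apply-⊞ f x y) (apply-⊞ g x y)) (⊞-interchange _ _ _ _) }
  where open F₂Space T; open F₂SpaceTheory T

BoolSpace : F₂Space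
BoolSpace = record
  { Carrier = Bool ; _⊞_ = _xor_ ; 0# = false
  ; ⊞-assoc = xor-assoc ; ⊞-comm = xor-comm ; ⊞-identityˡ = λ _ → refl ; ⊞-self = xor-same }

VecSpace : F₂Space → ℕ → F₂Space
VecSpace S k = record
  { Carrier = Vec Carrier k ; _⊞_ = zipWith _⊞_ ; 0# = replicate k 0#
  ; ⊞-assoc = zipWith-assoc ⊞-assoc ; ⊞-comm = zipWith-comm ⊞-comm
  ; ⊞-identityˡ = zipWith-identityˡ ⊞-identityˡ ; ⊞-self = self }
  where
  open F₂Space S
  self : ∀ {k} (x : Vec Carrier k) → zipWith _⊞_ x x ≡ replicate k 0#
  self []       = refl
  self (x ∷ xs) = cong₂ _∷_ (⊞-self x) (self xs)

-- F₂ⁿ; its carrier, sum and zero are literally Defs.F2^, Defs._⊕_, Defs.zeroV.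
F₂ⁿ : ℕ → F₂Space
F₂ⁿ n = VecSpace BoolSpace n

module F₂ⁿ {n : ℕ} = F₂SpaceTheory (F₂ⁿ n)

cons0ₗ : ∀ {S k} → Linear (VecSpace S k) (VecSpace S (suc k))
cons0ₗ {S} = record { apply = 0# ∷_ ; apply-⊞ = λ x y → cong (_∷ _) (sym (⊞-self 0#)) }
  where open F₂Space S

mapₗ : ∀ {S T k} → Linear S T → Linear (VecSpace S k) (VecSpace T k)
mapₗ {S} {T} f = record { apply = map (apply f) ; apply-⊞ = map-⊞ }
  where
  map-⊞ : ∀ {k} (x y : Vec (F₂Space.Carrier S) k) →
          map (apply f) (zipWith (F₂Space._⊞_ S) x y) ≡ zipWith (F₂Space._⊞_ T) (map (apply f) x) (map (apply f) y)
  map-⊞ []      []      = refl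
  map-⊞ (a ∷ x) (b ∷ y) = cong₂ _∷_ (apply-⊞ f a b) (map-⊞ x y)

firstₗ : ∀ {S k} → Linear S (VecSpace S (suc k))
firstₗ {S} {k} = record { apply = λ x → x ∷ replicate k 0# ; apply-⊞ = λ x y → cong (_ ∷_) (sym (F₂Space.⊞-self (VecSpace S k) _)) }
  where open F₂Space S

scaleₗ : ∀ {k} (u : F2^ k) → Linear BoolSpace (F₂ⁿ k)
scaleₗ u = record { apply = λ c → F₂ⁿ.scale c u ; apply-⊞ = λ a b → F₂ⁿ.scale-xor a b u }

headₗ : ∀ {k} → Linear (F₂ⁿ (suc k)) BoolSpace
headₗ = record { apply = head ; apply-⊞ = λ { (a ∷ x) (b ∷ y) → refl } }

clearHeadₗ : ∀ {k} → Linear (F₂ⁿ (suc k)) (F₂ⁿ (suc k))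
clearHeadₗ = record { apply = λ w → false ∷ tail w ; apply-⊞ = λ { (a ∷ x) (b ∷ y) → refl } }

++-⊕ : ∀ {a b} (A A′ : F2^ a) (B B′ : F2^ b) → (A ++ B) ⊕ (A′ ++ B′) ≡ (A ⊕ A′) ++ (B ⊕ B′)
++-⊕ []      []        B B′ = refl
++-⊕ (x ∷ A) (x′ ∷ A′) B B′ = cong ((x xor x′) ∷_) (++-⊕ A A′ B B′)

concatₗ : ∀ {n k} → Linear (VecSpace (F₂ⁿ n) k) (F₂ⁿ (k * n))
concatₗ {n} = record { apply = concat ; apply-⊞ = concat-⊞ }
  where
  concat-⊞ : ∀ {k} (M M′ : Vec (F2^ n) k) → concat (zipWith _⊕_ M M′) ≡ concat M ⊕ concat M′
  concat-⊞ []      []        = refl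
  concat-⊞ (B ∷ M) (B′ ∷ M′) = trans (cong ((B ⊕ B′) ++_) (concat-⊞ M M′)) (sym (++-⊕ B B′ (concat M) (concat M′)))

lc≡lincomb : ∀ {n d} (bs : Vec (F2^ n) d) cs → F₂ⁿ.lc bs cs ≡ lincomb bs cs
lc≡lincomb []       []          = refl
lc≡lincomb (b ∷ bs) (true ∷ cs)  = cong (b ⊕_) (lc≡lincomb bs cs)
lc≡lincomb (b ∷ bs) (false ∷ cs) = lc≡lincomb bs cs

units : ∀ d → Vec (F2^ d) d
units zero    = []
units (suc d) = (true ∷ zeroV) ∷ map (false ∷_) (units d)

lc-units : ∀ d (cs : F2^ d) → F₂ⁿ.lc (units d) cs ≡ cs
lc-units zero    []       = refl
lc-units (suc d) (c ∷ cs) = begin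
  F₂ⁿ.lc (units (suc d)) (c ∷ cs)                                 ≡⟨ F₂ⁿ.lc-∷ (true ∷ zeroV) (map (false ∷_) (units d)) c cs ⟩
  F₂ⁿ.scale c (true ∷ zeroV) ⊕ F₂ⁿ.lc (map (false ∷_) (units d)) cs ≡⟨ cong (F₂ⁿ.scale c (true ∷ zeroV) ⊕_) (lc-map (cons0ₗ {BoolSpace}) (units d) cs) ⟩
  F₂ⁿ.scale c (true ∷ zeroV) ⊕ (false ∷ F₂ⁿ.lc (units d) cs)       ≡⟨ cong (λ v → F₂ⁿ.scale c (true ∷ zeroV) ⊕ (false ∷ v)) (lc-units d cs) ⟩
  F₂ⁿ.scale c (true ∷ zeroV) ⊕ (false ∷ cs)                        ≡⟨ head-term c ⟩
  c ∷ cs                                                            ∎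
  where
  open ≡-Reasoning
  head-term : ∀ c → F₂ⁿ.scale c (true ∷ zeroV) ⊕ (false ∷ cs) ≡ c ∷ cs
  head-term true  = cong (true ∷_) (F₂Space.⊞-identityˡ (F₂ⁿ d) cs)
  head-term false = cong (false ∷_) (F₂Space.⊞-identityˡ (F₂ⁿ d) cs)

span-units : ∀ d (x : F2^ d) → F₂ⁿ.InSpan (units d) x
span-units d x = x , lc-units d x

searchCoefficients : ∀ d (P : Vec Bool d → Set) → (∀ cs → Dec (P cs)) →
                     (∀ cs → ¬ P cs) ⊎ Σ (Vec Bool d) P
searchCoefficients zero P P? with P? []
... | yes p  = inj₂ ([] , p)
... | no ¬p = inj₁ λ { [] → ¬p }
searchCoefficients (suc d) P P?
  with searchCoefficients d (λ cs → P (true ∷ cs)) (λ cs → P? (true ∷ cs))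
     | searchCoefficients d (λ cs → P (false ∷ cs)) (λ cs → P? (false ∷ cs))
... | inj₂ (cs , p) | _              = inj₂ (true ∷ cs , p)
... | inj₁ _        | inj₂ (cs , p)  = inj₂ (false ∷ cs , p)
... | inj₁ ¬pt      | inj₁ ¬pf       = inj₁ λ { (true ∷ cs) → ¬pt cs ; (false ∷ cs) → ¬pf cs }

nonzero-coordinate : ∀ {d} (cs : Vec Bool d) → ¬ cs ≡ replicate d false → Σ (Fin d) λ j → lookup cs j ≡ true
nonzero-coordinate []           cs≢0 = ⊥-elim (cs≢0 refl)
nonzero-coordinate (true ∷ cs)  cs≢0 = Fin.zero , refl
nonzero-coordinate (false ∷ cs) cs≢0 with nonzero-coordinate cs (λ e → cs≢0 (cong (false ∷_) e))
... | j , cⱼ = Fin.suc j , cⱼ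

-- Every finite family in an F₂-space with decidable equality contains a
-- linearly independent subfamily with the same span: repeatedly discard a
-- vector occurring with coefficient 1 in a nontrivial relation.
module BasisExtraction (S : F₂Space) (_≟_ : DecidableEquality (F₂Space.Carrier S)) where
  open F₂Space S
  open F₂SpaceTheory S

  Independent : ∀ {d} → Vec Carrier d → Set
  Independent {d} bs = ∀ cs → lc bs cs ≡ 0# → cs ≡ replicate d false

  LinearRelation : ∀ {d} → Vec Carrier d → Vec Bool d → Set
  LinearRelation {d} bs cs = lc bs cs ≡ 0# × ¬ cs ≡ replicate d false

  independent-or-relation : ∀ {d} (bs : Vec Carrier d) → Independent bs ⊎ Σ (Vec Bool d) (LinearRelation bs)
  independent-or-relation {d} bs
    with searchCoefficients d (LinearRelation bs) (λ cs → (lc bs cs ≟ 0#) ×-dec ¬? (≡-dec _≟ᵇ_ cs _))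
  ... | inj₂ rel        = inj₂ rel
  ... | inj₁ no-relation = inj₁ independent
    where
    independent : Independent bs
    independent cs lc≡0 with ≡-dec _≟ᵇ_ cs (replicate d false)
    ... | yes cs≡0 = cs≡0
    ... | no cs≢0  = ⊥-elim (no-relation cs (lc≡0 , cs≢0))

  record SubBasis {k} (G : Vec Carrier k) : Set where
    field
      dim         : ℕ
      dim≤k       : dim ≤ k
      basis       : Vec Carrier dim
      sound       : ∀ {x} → InSpan basis x → InSpan G x
      complete    : ∀ {x} → InSpan G x → InSpan basis x
      independent : Independent basis

  extract : ∀ {k} (G : Vec Carrier k) → SubBasis G
  extract {k} G with independent-or-relation G
  ... | inj₁ ind = record { dim = k ; dim≤k = ≤-refl ; basis = G
                          ; sound = λ s → s ; complete = λ s → s ; independent = ind }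
  extract {zero}  G | inj₂ ([] , _ , cs≢0) = ⊥-elim (cs≢0 refl)
  extract {suc k} G | inj₂ (cs , rel , cs≢0) with nonzero-coordinate cs cs≢0
  ... | j , cⱼ = record
    { dim         = dim
    ; dim≤k       = ≤-trans dim≤k (n≤1+n k)
    ; basis       = basis
    ; sound       = λ s → span-removeAt⊆ G j (sound s)
    ; complete    = λ s → complete (span⊆removeAt G j (dependent∈span G cs j rel cⱼ) s)
    ; independent = independent }
    where open SubBasis (extract (removeAt G j))

spanSubspace : ∀ {N k} → Vec (F2^ N) k → Subspace N
spanSubspace G = record { _∈U = F₂ⁿ.InSpan G ; zero∈ = F₂ⁿ.span-0 G ; ⊕∈ = F₂ⁿ.span-⊞ G }

span-codim : ∀ {N k} (G : Vec (F2^ N) k) → k ≤ N →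
             Σ ℕ λ c → N ∸ k ≤ c × HasCodim (spanSubspace G) c
span-codim {N} G k≤N =
  N ∸ dim , ∸-monoʳ-≤ N dim≤k , m∸n≤m N dim ,
  subst (HasDim (spanSubspace G)) (sym (m∸[m∸n]≡n (≤-trans dim≤k k≤N))) (basis , isBasis)
  where
  open BasisExtraction (F₂ⁿ N) (≡-dec _≟ᵇ_)
  open SubBasis (extract G)
  allIn : ∀ {d} (bs : Vec (F2^ N) d) → (∀ {x} → F₂ⁿ.InSpan bs x → F₂ⁿ.InSpan G x) → AllIn (spanSubspace G) bs
  allIn []       _   = tt
  allIn (b ∷ bs) bs⊆ = bs⊆ (F₂ⁿ.span-head b bs) , allIn bs (λ s → bs⊆ (F₂ⁿ.span-tail b bs s))
  isBasis : IsBasis (spanSubspace G) basis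
  isBasis = allIn basis sound
          , (λ cs e → independent cs (trans (lc≡lincomb basis cs) e))
          , (λ v s → let (cs , p) = complete s in cs , trans (sym (lc≡lincomb basis cs)) p)

basis-spans : ∀ {N d} (U : Subspace N) (bs : Vec (F2^ N) d) → IsBasis U bs → ∀ {x} → _∈U U x → F₂ⁿ.InSpan bs x
basis-spans U bs (_ , _ , spans) x∈U with spans _ x∈U
... | cs , p = cs , trans (lc≡lincomb bs cs) p

σ^-+ : ∀ {n} a b (x : F2^ n) → σ^ (a + b) x ≡ σ^ a (σ^ b x)
σ^-+ zero    b x = refl
σ^-+ (suc a) b x = cong σ (σ^-+ a b x)

toList-injective : ∀ {A : Set} {n} (xs ys : Vec A n) → toList xs ≡ toList ys → xs ≡ ys
toList-injective []       []       e = refl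
toList-injective (x ∷ xs) (y ∷ ys) e = cong₂ _∷_ (List.∷-injectiveˡ e) (toList-injective xs ys (List.∷-injectiveʳ e))

σ-∷ʳ : ∀ {n} (P : F2^ n) l → σ (P ∷ʳ l) ≡ l ∷ P
σ-∷ʳ P l = cong₂ _∷_ (last-∷ʳ l P) (init-∷ʳ l P)

σ-toList-∷ʳ : ∀ {N} (x : F2^ N) L a → toList x ≡ L List.∷ʳ a → toList (σ x) ≡ a List.∷ L
σ-toList-∷ʳ {zero}  [] List.[]       a ()
σ-toList-∷ʳ {zero}  [] (_ List.∷ _) a ()
σ-toList-∷ʳ {suc N} x  L             a e with initLast x
... | P , l , refl with List.∷ʳ-injective (toList P) L (trans (sym (toList-∷ʳ l P)) e)
... | P≡L , l≡a = cong₂ List._∷_ l≡a P≡L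

σ^-rotate : ∀ {N} A B (x : F2^ N) → toList x ≡ B List.++ A → toList (σ^ (List.length A) x) ≡ A List.++ B
σ^-rotate List.[]       B x e = trans e (List.++-identityʳ B)
σ^-rotate (a List.∷ A) B x e =
  σ-toList-∷ʳ (σ^ (List.length A) x) (A List.++ B) a
    (trans (σ^-rotate A (B List.∷ʳ a) x (trans e (sym (List.++-assoc B List.[ a ] A))))
           (sym (List.++-assoc A B List.[ a ])))

σ^-period : ∀ {n} (x : F2^ n) → σ^ n x ≡ x
σ^-period {n} x = toList-injective (σ^ n x) x
  (subst (λ k → toList (σ^ k x) ≡ toList x) (length-toList x)
         (trans (σ^-rotate (toList x) List.[] x refl) (List.++-identityʳ (toList x))))

σ^-multiple : ∀ {n} k (x : F2^ n) → σ^ (k * n) x ≡ x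
σ^-multiple         zero    x = refl
σ^-multiple {n} (suc k) x = trans (σ^-+ n (k * n) x) (trans (cong (σ^ n) (σ^-multiple k x)) (σ^-period x))

σ^-mod : ∀ {N} j (x : F2^ (suc N)) → σ^ j x ≡ σ^ (j % suc N) x
σ^-mod {N} j x = begin
  σ^ j x                                        ≡⟨ cong (λ k → σ^ k x) (m≡m%n+[m/n]*n j (suc N)) ⟩
  σ^ (j % suc N + (j / suc N) * suc N) x        ≡⟨ σ^-+ (j % suc N) _ x ⟩
  σ^ (j % suc N) (σ^ ((j / suc N) * suc N) x)   ≡⟨ cong (σ^ (j % suc N)) (σ^-multiple (j / suc N) x) ⟩
  σ^ (j % suc N) x                              ∎
  where open ≡-Reasoning

σ^-inverse : ∀ {N} r → r < suc N → Σ ℕ λ i → i < suc N × ∀ (x : F2^ (suc N)) → σ^ i (σ^ r x) ≡ x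
σ^-inverse         zero    _   = zero , s≤s z≤n , λ x → refl
σ^-inverse {N} (suc k) r<N = suc N ∸ suc k , s≤s (m∸n≤m N k) , λ x →
  trans (sym (σ^-+ (suc N ∸ suc k) (suc k) x))
        (trans (cong (λ i → σ^ i x) (m∸n+n≡m (<⇒≤ r<N))) (σ^-period x))

shifts-into⇒covering : ∀ {N} (U : Subspace (suc N)) →
  (∀ v → Σ ℕ λ j → _∈U U (σ^ j v)) → CyclicallyCovering U
shifts-into⇒covering {N} U reach v with reach v
... | j , σʲv∈U with σ^-inverse (j % suc N) (m%n<n j (suc N))
... | i , i<N , undo = i , i<N , σ^ (j % suc N) v , subst (_∈U U) (σ^-mod j v) σʲv∈U , undo v

shiftIn : ∀ {k} → Bool → F2^ k → F2^ k
shiftIn c []       = []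
shiftIn c (x ∷ xs) = c ∷ shiftIn x xs

shiftOut : ∀ {k} → Bool → F2^ k → Bool
shiftOut c []       = c
shiftOut c (x ∷ xs) = shiftOut x xs

shiftIn-∷ʳ : ∀ {k} c (P : F2^ k) l → shiftIn c (P ∷ʳ l) ≡ c ∷ P
shiftIn-∷ʳ c []      l = refl
shiftIn-∷ʳ c (p ∷ P) l = cong (c ∷_) (shiftIn-∷ʳ p P l)

shiftOut-∷ʳ : ∀ {k} c (P : F2^ k) l → shiftOut c (P ∷ʳ l) ≡ l
shiftOut-∷ʳ c []      l = refl
shiftOut-∷ʳ c (p ∷ P) l = shiftOut-∷ʳ p P l

σ-shiftIn : ∀ {k} (x : F2^ (suc k)) → σ x ≡ shiftIn (last x) x
σ-shiftIn x with initLast x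
... | P , l , refl = sym (shiftIn-∷ʳ l P l)

shiftOut-last : ∀ {k} c (x : F2^ (suc k)) → shiftOut c x ≡ last x
shiftOut-last c x with initLast x
... | P , l , refl = shiftOut-∷ʳ c P l

shiftIn-++ : ∀ {a b} c (A : F2^ a) (B : F2^ b) → shiftIn c (A ++ B) ≡ shiftIn c A ++ shiftIn (shiftOut c A) B
shiftIn-++ c []      B = refl
shiftIn-++ c (x ∷ A) B = cong (c ∷_) (shiftIn-++ x A B)

shiftOut-++ : ∀ {a b} c (A : F2^ a) (B : F2^ b) → shiftOut c (A ++ B) ≡ shiftOut (shiftOut c A) B
shiftOut-++ c []      B = refl
shiftOut-++ c (x ∷ A) B = shiftOut-++ x A B

shiftIn-⊕ : ∀ {k} b c (X Y : F2^ k) → shiftIn b X ⊕ shiftIn c Y ≡ shiftIn (b xor c) (X ⊕ Y)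
shiftIn-⊕ b c []      []      = refl
shiftIn-⊕ b c (x ∷ X) (y ∷ Y) = cong ((b xor c) ∷_) (shiftIn-⊕ x y X Y)

shiftOut-⊕ : ∀ {k} b c (X Y : F2^ k) → shiftOut (b xor c) (X ⊕ Y) ≡ shiftOut b X xor shiftOut c Y
shiftOut-⊕ b c []      []      = refl
shiftOut-⊕ b c (x ∷ X) (y ∷ Y) = shiftOut-⊕ x y X Y

shiftIn-zero : ∀ {k} → shiftIn false (zeroV {k}) ≡ zeroV
shiftIn-zero {zero}  = refl
shiftIn-zero {suc k} = cong (false ∷_) (shiftIn-zero {k})

shiftOut-zero : ∀ {k} → shiftOut false (zeroV {k}) ≡ false
shiftOut-zero {zero}  = refl
shiftOut-zero {suc k} = shiftOut-zero {k}

shiftOut-nonempty : ∀ {k} b c (x : F2^ (suc k)) → shiftOut b x ≡ shiftOut c x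
shiftOut-nonempty b c (x ∷ xs) = refl

shiftInBlocks : ∀ {n m} → Bool → Vec (F2^ n) m → Vec (F2^ n) m
shiftInBlocks c []      = []
shiftInBlocks c (B ∷ M) = shiftIn c B ∷ shiftInBlocks (shiftOut c B) M

carryOut : ∀ {n m} → Bool → Vec (F2^ n) m → Bool
carryOut c []      = c
carryOut c (B ∷ M) = carryOut (shiftOut c B) M

totalCarry : ∀ {n m} → Bool → Vec (F2^ n) m → Bool
totalCarry c []      = false
totalCarry c (B ∷ M) = c xor totalCarry (shiftOut c B) M

shiftIn-concat : ∀ {n m} c (M : Vec (F2^ n) m) → shiftIn c (concat M) ≡ concat (shiftInBlocks c M)
shiftIn-concat c []      = refl
shiftIn-concat c (B ∷ M) = trans (shiftIn-++ c B (concat M)) (cong (shiftIn c B ++_) (shiftIn-concat (shiftOut c B) M))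

shiftOut-concat : ∀ {n m} c (M : Vec (F2^ n) m) → shiftOut c (concat M) ≡ carryOut c M
shiftOut-concat c []      = refl
shiftOut-concat c (B ∷ M) = trans (shiftOut-++ c B (concat M)) (shiftOut-concat (shiftOut c B) M)

blockSum : ∀ {n m} → Vec (F2^ n) m → F2^ n
blockSum []      = zeroV
blockSum (B ∷ M) = B ⊕ blockSum M

blockSum-shiftInBlocks : ∀ {n m} c (M : Vec (F2^ n) m) →
  blockSum (shiftInBlocks c M) ≡ shiftIn (totalCarry c M) (blockSum M)
blockSum-shiftInBlocks {n} c [] = sym (shiftIn-zero {n})
blockSum-shiftInBlocks c (B ∷ M) =
  trans (cong (shiftIn c B ⊕_) (blockSum-shiftInBlocks (shiftOut c B) M)) (shiftIn-⊕ c _ B (blockSum M))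

carry-balance : ∀ {n m} c (M : Vec (F2^ (suc n)) m) →
  totalCarry c M xor carryOut c M ≡ c xor shiftOut false (blockSum M)
carry-balance {n} c [] = trans (sym (xor-identityʳ c)) (cong (c xor_) (sym (shiftOut-zero {suc n})))
carry-balance c (B ∷ M) = begin
  (c xor totalCarry c′ M) xor carryOut c′ M           ≡⟨ xor-assoc c _ _ ⟩
  c xor (totalCarry c′ M xor carryOut c′ M)           ≡⟨ cong (c xor_) (carry-balance c′ M) ⟩
  c xor (c′ xor shiftOut false (blockSum M))          ≡⟨ cong (λ d → c xor (d xor shiftOut false (blockSum M))) (shiftOut-nonempty c false B) ⟩
  c xor (shiftOut false B xor shiftOut false (blockSum M)) ≡⟨ cong (c xor_) (sym (shiftOut-⊕ false false B (blockSum M))) ⟩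
  c xor shiftOut false (B ⊕ blockSum M)               ∎
  where
  open ≡-Reasoning
  c′ = shiftOut c B

blockSum-σ : ∀ {n m} (M : Vec (F2^ (suc n)) (suc m)) →
  blockSum (shiftInBlocks (last (concat M)) M) ≡ σ (blockSum M)
blockSum-σ M = begin
  blockSum (shiftInBlocks c M)              ≡⟨ blockSum-shiftInBlocks c M ⟩
  shiftIn (totalCarry c M) (blockSum M)     ≡⟨ cong (λ d → shiftIn d (blockSum M)) total≡last ⟩
  shiftIn (last (blockSum M)) (blockSum M)  ≡⟨ sym (σ-shiftIn (blockSum M)) ⟩
  σ (blockSum M)                            ∎
  where
  open ≡-Reasoning
  open F₂SpaceTheory BoolSpace using (⊞-cancelʳ)
  c = last (concat M)
  cyclic : carryOut c M ≡ c
  cyclic = trans (sym (shiftOut-concat c M)) (shiftOut-last c (concat M))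
  total≡last : totalCarry c M ≡ last (blockSum M)
  total≡last = begin
    totalCarry c M                                  ≡⟨ sym (⊞-cancelʳ (totalCarry c M) (carryOut c M)) ⟩
    (totalCarry c M xor carryOut c M) xor carryOut c M ≡⟨ cong₂ _xor_ (carry-balance c M) cyclic ⟩
    (c xor shiftOut false (blockSum M)) xor c       ≡⟨ cong (_xor c) (xor-comm c _) ⟩
    (shiftOut false (blockSum M) xor c) xor c       ≡⟨ ⊞-cancelʳ _ c ⟩
    shiftOut false (blockSum M)                     ≡⟨ shiftOut-last false (blockSum M) ⟩
    last (blockSum M)                               ∎

toList-concat-∷ʳ : ∀ {n m} (P : Vec (F2^ n) m) L → toList (concat (P ∷ʳ L)) ≡ toList (concat P) List.++ toList L
toList-concat-∷ʳ []      L = trans (toList-++ L []) (List.++-identityʳ _)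
toList-concat-∷ʳ (p ∷ P) L = begin
  toList (p ++ concat (P ∷ʳ L))                      ≡⟨ toList-++ p _ ⟩
  toList p List.++ toList (concat (P ∷ʳ L))          ≡⟨ cong (toList p List.++_) (toList-concat-∷ʳ P L) ⟩
  toList p List.++ (toList (concat P) List.++ toList L) ≡⟨ sym (List.++-assoc (toList p) _ _) ⟩
  (toList p List.++ toList (concat P)) List.++ toList L ≡⟨ cong (List._++ toList L) (sym (toList-++ p (concat P))) ⟩
  toList (p ++ concat P) List.++ toList L            ∎
  where open ≡-Reasoning

map-rotate : ∀ {A : Set} {m} (f : A → Bool) (M : Vec A (suc m)) → map f (last M ∷ init M) ≡ σ (map f M)
map-rotate f M with initLast M
... | P , L , refl = sym (trans (cong σ (map-∷ʳ f L P)) (σ-∷ʳ (map f P) (f L)))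

σ^-concat : ∀ {n m} (M : Vec (F2^ n) (suc m)) → σ^ n (concat M) ≡ concat (last M ∷ init M)
σ^-concat {n} M with initLast M
... | P , L , refl = toList-injective _ _
  (subst (λ k → toList (σ^ k (concat (P ∷ʳ L))) ≡ toList (concat (L ∷ P))) (length-toList L)
    (trans (σ^-rotate (toList L) (toList (concat P)) (concat (P ∷ʳ L)) (toList-concat-∷ʳ P L))
           (sym (toList-++ L (concat P)))))

concat-injective : ∀ {n m} (M M′ : Vec (F2^ n) m) → concat M ≡ concat M′ → M ≡ M′
concat-injective []      []        e = refl
concat-injective (B ∷ M) (B′ ∷ M′) e with ++-injective B B′ e
... | B≡B′ , rest = cong₂ _∷_ B≡B′ (concat-injective M M′ rest)

module Blocks (m′ n′ : ℕ) where
  m = suc m′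
  n = suc n′

  blocksOf : F2^ (m * n) → Vec (F2^ n) m
  blocksOf y = proj₁ (group m n y)

  concat-blocksOf : ∀ y → concat (blocksOf y) ≡ y
  concat-blocksOf y = sym (proj₂ (group m n y))

  blocksOf-concat : ∀ M → blocksOf (concat M) ≡ M
  blocksOf-concat M = concat-injective _ M (concat-blocksOf (concat M))

  sumOfBlocks : F2^ (m * n) → F2^ n
  sumOfBlocks y = blockSum (blocksOf y)

  heads : F2^ (m * n) → F2^ m
  heads y = map head (blocksOf y)

  sumOfBlocks-σ : ∀ y → sumOfBlocks (σ y) ≡ σ (sumOfBlocks y)
  sumOfBlocks-σ y = begin
    blockSum (blocksOf (σ y))                                  ≡⟨ cong (λ z → blockSum (blocksOf (σ z))) (sym (concat-blocksOf y)) ⟩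
    blockSum (blocksOf (σ (concat M)))                         ≡⟨ cong (λ z → blockSum (blocksOf z)) (σ-shiftIn (concat M)) ⟩
    blockSum (blocksOf (shiftIn c (concat M)))                 ≡⟨ cong (λ z → blockSum (blocksOf z)) (shiftIn-concat c M) ⟩
    blockSum (blocksOf (concat (shiftInBlocks c M)))           ≡⟨ cong blockSum (blocksOf-concat (shiftInBlocks c M)) ⟩
    blockSum (shiftInBlocks c M)                               ≡⟨ blockSum-σ M ⟩
    σ (blockSum M)                                             ∎
    where
    open ≡-Reasoning
    M = blocksOf y
    c = last (concat M)

  sumOfBlocks-σ^ : ∀ k y → sumOfBlocks (σ^ k y) ≡ σ^ k (sumOfBlocks y)
  sumOfBlocks-σ^ zero    y = refl
  sumOfBlocks-σ^ (suc k) y = trans (sumOfBlocks-σ (σ^ k y)) (cong σ (sumOfBlocks-σ^ k y))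

  heads-σⁿ : ∀ y → heads (σ^ n y) ≡ σ (heads y)
  heads-σⁿ y = begin
    map head (blocksOf (σ^ n y))                    ≡⟨ cong (λ z → map head (blocksOf (σ^ n z))) (sym (concat-blocksOf y)) ⟩
    map head (blocksOf (σ^ n (concat M)))           ≡⟨ cong (λ z → map head (blocksOf z)) (σ^-concat M) ⟩
    map head (blocksOf (concat (last M ∷ init M)))  ≡⟨ cong (map head) (blocksOf-concat (last M ∷ init M)) ⟩
    map head (last M ∷ init M)                      ≡⟨ map-rotate head M ⟩
    σ (map head M)                                  ∎
    where
    open ≡-Reasoning
    M = blocksOf y

  heads-σ^ : ∀ k y → heads (σ^ (k * n) y) ≡ σ^ k (heads y)
  heads-σ^ zero    y = refl
  heads-σ^ (suc k) y = begin
    heads (σ^ (n + k * n) y)   ≡⟨ cong heads (σ^-+ n (k * n) y) ⟩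
    heads (σ^ n (σ^ (k * n) y)) ≡⟨ heads-σⁿ (σ^ (k * n) y) ⟩
    σ (heads (σ^ (k * n) y))   ≡⟨ cong σ (heads-σ^ k y) ⟩
    σ (σ^ k (heads y))         ∎
    where open ≡-Reasoning

  -- Every word can be shifted so that its block sum lies in W and then, by a
  -- further shift through a multiple of n (which fixes the block sum), so
  -- that its heads lie in U.
  shift-into : (U : Subspace m) (W : Subspace n) → CyclicallyCovering U → CyclicallyCovering W →
    ∀ v → Σ ℕ λ j → _∈U U (heads (σ^ j v)) × _∈U W (sumOfBlocks (σ^ j v))
  shift-into U W U-covering W-covering v with W-covering (sumOfBlocks v)
  ... | i₁ , i₁<n , w , w∈W , σⁱ¹w≡sum with σ^-inverse i₁ i₁<n
  ... | j₁ , _ , undo₁ with U-covering (heads (σ^ j₁ v))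
  ... | i₂ , i₂<m , u , u∈U , σⁱ²u≡heads with σ^-inverse i₂ i₂<m
  ... | j₂ , _ , undo₂ = j₂ * n + j₁ , subst (_∈U U) (sym heads≡u) u∈U , subst (_∈U W) (sym sum≡w) w∈W
    where
    open ≡-Reasoning
    y = σ^ j₁ v
    sum-y : sumOfBlocks y ≡ w
    sum-y = begin
      sumOfBlocks (σ^ j₁ v)   ≡⟨ sumOfBlocks-σ^ j₁ v ⟩
      σ^ j₁ (sumOfBlocks v)   ≡⟨ cong (σ^ j₁) (sym σⁱ¹w≡sum) ⟩
      σ^ j₁ (σ^ i₁ w)         ≡⟨ undo₁ w ⟩
      w                       ∎
    heads≡u : heads (σ^ (j₂ * n + j₁) v) ≡ u
    heads≡u = begin
      heads (σ^ (j₂ * n + j₁) v)  ≡⟨ cong heads (σ^-+ (j₂ * n) j₁ v) ⟩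
      heads (σ^ (j₂ * n) y)       ≡⟨ heads-σ^ j₂ y ⟩
      σ^ j₂ (heads y)             ≡⟨ cong (σ^ j₂) (sym σⁱ²u≡heads) ⟩
      σ^ j₂ (σ^ i₂ u)             ≡⟨ undo₂ u ⟩
      u                           ∎
    sum≡w : sumOfBlocks (σ^ (j₂ * n + j₁) v) ≡ w
    sum≡w = begin
      sumOfBlocks (σ^ (j₂ * n + j₁) v)  ≡⟨ cong sumOfBlocks (σ^-+ (j₂ * n) j₁ v) ⟩
      sumOfBlocks (σ^ (j₂ * n) y)       ≡⟨ sumOfBlocks-σ^ (j₂ * n) y ⟩
      σ^ (j₂ * n) (sumOfBlocks y)       ≡⟨ σ^-multiple j₂ (sumOfBlocks y) ⟩
      sumOfBlocks y                     ≡⟨ sum-y ⟩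
      w                                 ∎

functional-witness : ∀ {S} (f : Linear S BoolSpace) {d} (bs : Vec (F₂Space.Carrier S) d) cs →
  apply f (F₂SpaceTheory.lc S bs cs) ≡ true → Σ (Fin d) λ j → apply f (lookup bs j) ≡ true
functional-witness f []       []       f0≡1 with trans (sym (apply-0 f)) f0≡1
... | ()
functional-witness {S} f (b ∷ bs) (c ∷ cs) f-lc≡1 with apply f b in fb
... | true  = Fin.zero , fb
... | false with functional-witness f bs cs (trans (sym drop-b) f-lc≡1)
  where
  open F₂SpaceTheory S using (lc; lc-∷; scale)
  drop-b : apply f (lc (b ∷ bs) (c ∷ cs)) ≡ apply f (lc bs cs)
  drop-b = begin
    apply f (lc (b ∷ bs) (c ∷ cs))                            ≡⟨ cong (apply f) (lc-∷ b bs c cs) ⟩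
    apply f (F₂Space._⊞_ S (scale c b) (lc bs cs))            ≡⟨ apply-⊞ f _ _ ⟩
    apply f (scale c b) xor apply f (lc bs cs)                ≡⟨ cong (_xor apply f (lc bs cs)) (apply-scale f c b) ⟩
    F₂SpaceTheory.scale BoolSpace c (apply f b) xor apply f (lc bs cs) ≡⟨ cong (λ x → F₂SpaceTheory.scale BoolSpace c x xor apply f (lc bs cs)) fb ⟩
    F₂SpaceTheory.scale BoolSpace c false xor apply f (lc bs cs) ≡⟨ cong (_xor apply f (lc bs cs)) (F₂SpaceTheory.scale-0 BoolSpace c) ⟩
    apply f (lc bs cs)                                        ∎
    where open ≡-Reasoning
... | j , fbⱼ = Fin.suc j , fbⱼ

parity : ∀ {k} → F2^ k → Bool
parity []       = false
parity (x ∷ xs) = x xor parity xs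

parityₗ : ∀ {k} → Linear (F₂ⁿ k) BoolSpace
parityₗ = record { apply = parity ; apply-⊞ = parity-⊕ }
  where
  parity-⊕ : ∀ {k} (x y : F2^ k) → parity (x ⊕ y) ≡ parity x xor parity y
  parity-⊕ []      []      = refl
  parity-⊕ (a ∷ x) (b ∷ y) = trans (cong ((a xor b) xor_) (parity-⊕ x y))
                                   (F₂SpaceTheory.⊞-interchange BoolSpace a b (parity x) (parity y))

parity-∷ʳ : ∀ {k} (P : F2^ k) l → parity (P ∷ʳ l) ≡ l xor parity P
parity-∷ʳ []      l = refl
parity-∷ʳ (p ∷ P) l = trans (cong (p xor_) (parity-∷ʳ P l)) (F₂SpaceTheory.⊞-lcomm BoolSpace p l (parity P))

parity-σ : ∀ {k} (x : F2^ k) → parity (σ x) ≡ parity x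
parity-σ {zero}  [] = refl
parity-σ {suc k} x with initLast x
... | P , l , refl = sym (parity-∷ʳ P l)

parity-σ^ : ∀ {k} i (x : F2^ k) → parity (σ^ i x) ≡ parity x
parity-σ^ zero    x = refl
parity-σ^ (suc i) x = trans (parity-σ (σ^ i x)) (parity-σ^ i x)

-- A cyclically covering subspace has a basis vector of odd parity: some
-- shift of one of its vectors is e₀, which has parity 1.
odd-basis-vector : ∀ {k d} (U : Subspace (suc k)) (bs : Vec (F2^ (suc k)) d) →
  CyclicallyCovering U → IsBasis U bs → Σ (Fin d) λ j → parity (lookup bs j) ≡ true
odd-basis-vector {k} U bs covering (_ , _ , spans) with covering (true ∷ zeroV)
... | i , _ , u , u∈U , σⁱu≡e₀ with spans u u∈U
... | cs , lincomb≡u = functional-witness parityₗ bs cs (begin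
  parity (F₂ⁿ.lc bs cs)   ≡⟨ cong parity (trans (lc≡lincomb bs cs) lincomb≡u) ⟩
  parity u               ≡⟨ sym (parity-σ^ i u) ⟩
  parity (σ^ i u)        ≡⟨ cong parity σⁱu≡e₀ ⟩
  true xor parity (zeroV {k}) ≡⟨ cong (true xor_) (apply-0 (parityₗ {k})) ⟩
  true                   ∎)
  where open ≡-Reasoning

-- x ↦ x + parity(x)·u; when u has odd parity this kills u and x + evenPart x
-- is a multiple of u.
evenPartₗ : ∀ {k} (u : F2^ k) → Linear (F₂ⁿ k) (F₂ⁿ k)
evenPartₗ u = idₗ +ₗ (scaleₗ u ∘ₗ parityₗ)

module ProductGenerators (m′ n′ : ℕ) where
  m = suc m′
  n = suc n′

  Blocksᵏ : ℕ → F₂Space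
  Blocksᵏ k = VecSpace (F₂ⁿ n) k

  module Blocksᵏ {k : ℕ} = F₂SpaceTheory (Blocksᵏ k)

  infixl 6 _⊞_
  _⊞_ : ∀ {k} → Vec (F2^ n) k → Vec (F2^ n) k → Vec (F2^ n) k
  _⊞_ {k} = F₂Space._⊞_ (Blocksᵏ k)

  placeHeadsₗ : ∀ {k} → Linear (F₂ⁿ k) (Blocksᵏ k)
  placeHeadsₗ = mapₗ (scaleₗ (true ∷ zeroV))

  placeHeads : ∀ {k} → F2^ k → Vec (F2^ n) k
  placeHeads = apply placeHeadsₗ

  placeTails : ∀ {k} → Vec (F2^ n′) k → Vec (F2^ n) k
  placeTails = map (false ∷_)

  -- T ↦ ((0,T), (0,T), 0, …, 0): block families with zero heads and zero tail sum.
  twinₗ : ∀ {k} → Linear (F₂ⁿ n′) (Blocksᵏ (suc (suc k)))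
  twinₗ {k} = record
    { apply   = λ T → (false ∷ T) ∷ (false ∷ T) ∷ replicate k zeroV
    ; apply-⊞ = λ x y → cong (λ r → (false ∷ (x ⊕ y)) ∷ (false ∷ (x ⊕ y)) ∷ r) (sym (F₂Space.⊞-self (Blocksᵏ k) _)) }

  balancedTails : ∀ k → Vec (Vec (F2^ n) (suc k)) (k * n′)
  balancedTails zero    = []
  balancedTails (suc k) = map (apply twinₗ) (units n′) ++ map (apply (cons0ₗ {F₂ⁿ n})) (balancedTails k)

  -- Tails Ts, with the first tail corrected so that the tails sum to zero.
  balance : ∀ {k} → Vec (F2^ n′) (suc k) → Vec (F2^ n) (suc k)
  balance Ts = placeTails Ts ⊞ apply (firstₗ {F₂ⁿ n}) (false ∷ blockSum Ts)

  balance-span : ∀ k (Ts : Vec (F2^ n′) (suc k)) → Blocksᵏ.InSpan (balancedTails k) (balance Ts)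
  balance-span zero    (T₀ ∷ [])      = subst (Blocksᵏ.InSpan []) (sym one-block) (Blocksᵏ.span-0 [])
    where
    one-block : balance (T₀ ∷ []) ≡ zeroV ∷ []
    one-block = cong (λ z → (false ∷ z) ∷ []) (F₂ⁿ.⊞-cancelˡ T₀ zeroV)
  balance-span (suc k) (T₀ ∷ T₁ ∷ Ts) = subst (Blocksᵏ.InSpan (balancedTails (suc k))) (sym split)
    (Blocksᵏ.span-++ (map (apply twinₗ) (units n′)) _
      (span-map twinₗ (units n′) (span-units n′ X))
      (span-map (cons0ₗ {F₂ⁿ n}) (balancedTails k) (balance-span k (T₁ ∷ Ts))))
    where
    X = T₁ ⊕ blockSum Ts
    first : (false ∷ T₀) ⊕ (false ∷ (T₀ ⊕ X)) ≡ (false ∷ X) ⊕ zeroV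
    first = trans (cong (false ∷_) (F₂ⁿ.⊞-cancelˡ T₀ X)) (sym (F₂ⁿ.⊞-identityʳ {n} _))
    second : (false ∷ T₁) ⊕ zeroV ≡ (false ∷ X) ⊕ ((false ∷ T₁) ⊕ (false ∷ X))
    second = trans (F₂ⁿ.⊞-identityʳ {n} (false ∷ T₁))
                   (sym (trans (cong ((false ∷ X) ⊕_) (F₂Space.⊞-comm (F₂ⁿ n) (false ∷ T₁) (false ∷ X))) (F₂ⁿ.⊞-cancelˡ (false ∷ X) (false ∷ T₁))))
    split : balance (T₀ ∷ T₁ ∷ Ts) ≡ apply twinₗ X ⊞ (zeroV ∷ balance (T₁ ∷ Ts))
    split = cong₂ _∷_ first (cong₂ _∷_ second (sym (F₂Space.⊞-identityˡ (Blocksᵏ k) _)))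

  heads+tails : ∀ {k} (M : Vec (F2^ n) k) → M ≡ placeHeads (map head M) ⊞ placeTails (map tail M)
  heads+tails []            = refl
  heads+tails ((h ∷ T) ∷ M) = cong₂ _∷_ (block h) (heads+tails M)
    where
    block : ∀ h → h ∷ T ≡ F₂ⁿ.scale h (true ∷ zeroV) ⊕ (false ∷ T)
    block true  = cong (true ∷_) (sym (F₂Space.⊞-identityˡ (F₂ⁿ n′) T))
    block false = cong (false ∷_) (sym (F₂Space.⊞-identityˡ (F₂ⁿ n′) T))

  blockSum-heads+tails : ∀ {k} (M : Vec (F2^ n) k) → blockSum M ≡ parity (map head M) ∷ blockSum (map tail M)
  blockSum-heads+tails []            = refl
  blockSum-heads+tails ((h ∷ T) ∷ M) = cong ((h ∷ T) ⊕_) (blockSum-heads+tails M)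

  liftSumₗ : F2^ m → Linear (F₂ⁿ n) (Blocksᵏ m)
  liftSumₗ u = (placeHeadsₗ ∘ₗ (scaleₗ u ∘ₗ headₗ)) +ₗ (firstₗ ∘ₗ clearHeadₗ)

  decomposition : ∀ u (M : Vec (F2^ n) m) →
    placeHeads (apply (evenPartₗ u) (map head M)) ⊞ (apply (liftSumₗ u) (blockSum M) ⊞ balance (map tail M)) ≡ M
  decomposition u M = begin
    ph (even H) ⊞ (apply (liftSumₗ u) (blockSum M) ⊞ balance Ts)
      ≡⟨ cong (λ w → ph (even H) ⊞ (apply (liftSumₗ u) w ⊞ balance Ts)) (blockSum-heads+tails M) ⟩
    ph (even H) ⊞ ((ph s ⊞ e) ⊞ (placeTails Ts ⊞ e))
      ≡⟨ cong (ph (even H) ⊞_) (Blocksᵏ.⊞-interchange (ph s) e (placeTails Ts) e) ⟩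
    ph (even H) ⊞ ((ph s ⊞ placeTails Ts) ⊞ (e ⊞ e))
      ≡⟨ cong (λ z → ph (even H) ⊞ ((ph s ⊞ placeTails Ts) ⊞ z)) (F₂Space.⊞-self (Blocksᵏ m) e) ⟩
    ph (even H) ⊞ ((ph s ⊞ placeTails Ts) ⊞ replicate m zeroV)
      ≡⟨ cong (ph (even H) ⊞_) (Blocksᵏ.⊞-identityʳ _) ⟩
    ph (even H) ⊞ (ph s ⊞ placeTails Ts)
      ≡⟨ sym (F₂Space.⊞-assoc (Blocksᵏ m) _ _ _) ⟩
    (ph (even H) ⊞ ph s) ⊞ placeTails Ts
      ≡⟨ cong (_⊞ placeTails Ts) (sym (apply-⊞ placeHeadsₗ (even H) s)) ⟩
    ph (even H ⊕ s) ⊞ placeTails Ts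
      ≡⟨ cong (λ z → ph z ⊞ placeTails Ts) (F₂ⁿ.⊞-cancelʳ H s) ⟩
    ph H ⊞ placeTails Ts
      ≡⟨ sym (heads+tails M) ⟩
    M ∎
    where
    open ≡-Reasoning
    ph   = placeHeads {m}
    even = apply (evenPartₗ u)
    H    = map head M
    Ts   = map tail M
    s    = F₂ⁿ.scale (parity H) u
    e    = apply (firstₗ {F₂ⁿ n}) (false ∷ blockSum Ts)

  family : ∀ {p′ dW} (bsU : Vec (F2^ m) (suc p′)) (j : Fin (suc p′)) (bsW : Vec (F2^ n) dW) →
           Vec (Vec (F2^ n) m) (p′ + (dW + m′ * n′))
  family bsU j bsW = map placeHeads (removeAt (map (apply (evenPartₗ (lookup bsU j))) bsU) j)
                  ++ (map (apply (liftSumₗ (lookup bsU j))) bsW ++ balancedTails m′)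

  family-span : ∀ {p′ dW} (bsU : Vec (F2^ m) (suc p′)) (j : Fin (suc p′)) (bsW : Vec (F2^ n) dW) →
    parity (lookup bsU j) ≡ true →
    ∀ M → F₂ⁿ.InSpan bsU (map head M) → F₂ⁿ.InSpan bsW (blockSum M) → Blocksᵏ.InSpan (family bsU j bsW) M
  family-span bsU j bsW odd M H∈ sum∈ = subst (Blocksᵏ.InSpan (family bsU j bsW)) (decomposition u₁ M)
    (Blocksᵏ.span-++ (map placeHeads evens) _
      (span-map placeHeadsₗ evens (F₂ⁿ.span⊆removeAt (map even bsU) j even-u₁∈ (span-map (evenPartₗ u₁) bsU H∈)))
      (Blocksᵏ.span-++ (map (apply (liftSumₗ u₁)) bsW) (balancedTails m′)
        (span-map (liftSumₗ u₁) bsW sum∈)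
        (balance-span m′ (map tail M))))
    where
    u₁    = lookup bsU j
    even  = apply (evenPartₗ u₁)
    evens = removeAt (map even bsU) j
    -- evenPart kills the odd vector u₁, so dropping it loses nothing
    even-u₁∈ : F₂ⁿ.InSpan evens (lookup (map even bsU) j)
    even-u₁∈ = subst (F₂ⁿ.InSpan evens)
      (sym (trans (lookup-map j even bsU) (trans (cong (λ c → u₁ ⊕ F₂ⁿ.scale c u₁) odd) (F₂Space.⊞-self (F₂ⁿ m) u₁))))
      (F₂ⁿ.span-0 evens)

generator-count : ∀ {m′ n′ p′ dW hm hn} → suc p′ + hm ≡ suc m′ → dW + hn ≡ suc n′ →
  let k = p′ + (dW + m′ * n′) in k ≤ suc m′ * suc n′ × suc m′ * suc n′ ∸ k ≡ hm + hn
generator-count {m′} {n′} {p′} {dW} {hm} {hn} refl dW+hn≡n =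
  subst (k ≤_) total (m≤m+n k (hm + hn)) , trans (cong (_∸ k) (sym total)) (m+n∸m≡n k (hm + hn))
  where
  k = p′ + (dW + (p′ + hm) * n′)
  regroup : ∀ p h d n′ hn → (p + (d + (p + h) * n′)) + (h + hn) ≡ (p + h) + (d + hn) + (p + h) * n′
  regroup = solve-∀
  expand : ∀ a n′ → suc a * suc n′ ≡ a + suc n′ + a * n′
  expand = solve-∀
  total : k + (hm + hn) ≡ suc (p′ + hm) * suc n′
  total = trans (regroup p′ hm dW n′ hn)
                (trans (cong (λ z → (p′ + hm) + z + (p′ + hm) * n′) dW+hn≡n) (sym (expand (p′ + hm) n′)))

product-covering : ∀ {m′ n′ hm hn} (U : Subspace (suc m′)) (W : Subspace (suc n′)) →
  CyclicallyCovering U → HasCodim U hm → CyclicallyCovering W → HasCodim W hn →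
  Σ (Subspace (suc m′ * suc n′)) λ S → CyclicallyCovering S × Σ ℕ λ c → hm + hn ≤ c × HasCodim S c
product-covering {m′} {n′} {hm} {hn} U W U-covering (hm≤m , bsU , bsU-basis) W-covering (hn≤n , bsW , bsW-basis) =
  build bsU bsU-basis (m∸n+n≡m hm≤m) (odd-basis-vector U bsU U-covering bsU-basis)
  where
  open Blocks m′ n′
  open ProductGenerators m′ n′ using (family; family-span)
  build : ∀ {dU} (bsU : Vec (F2^ m) dU) → IsBasis U bsU → dU + hm ≡ m →
          Σ (Fin dU) (λ j → parity (lookup bsU j) ≡ true) →
          Σ (Subspace (m * n)) λ S → CyclicallyCovering S × Σ ℕ λ c → hm + hn ≤ c × HasCodim S c
  build {zero}   bsU _         _       (() , _)
  build {suc p′} bsU bsU-basis dU+hm≡m (j , odd) =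
    spanSubspace G , covering , c , subst (_≤ c) (proj₂ count) mn∸k≤c , codim
    where
    G = map concat (family bsU j bsW)
    G-spans : ∀ y → _∈U U (heads y) → _∈U W (sumOfBlocks y) → F₂ⁿ.InSpan G y
    G-spans y heads∈U sum∈W = subst (F₂ⁿ.InSpan G) (concat-blocksOf y)
      (span-map concatₗ (family bsU j bsW)
        (family-span bsU j bsW odd (blocksOf y) (basis-spans U bsU bsU-basis heads∈U) (basis-spans W bsW bsW-basis sum∈W)))
    covering : CyclicallyCovering (spanSubspace G)
    covering = shifts-into⇒covering (spanSubspace G) λ v →
      let (k , heads∈U , sum∈W) = shift-into U W U-covering W-covering v in k , G-spans _ heads∈U sum∈W
    count = generator-count {m′} {n′} {p′} {n ∸ hn} {hm} {hn} dU+hm≡m (m∸n+n≡m hn≤n)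
    bound = span-codim G (proj₁ count)
    c = proj₁ bound
    mn∸k≤c = proj₁ (proj₂ bound)
    codim = proj₂ (proj₂ bound)

-- F₂⁰ has no cyclically covering subspace: there are no shifts σⁱ with i < 0.
no-covering-of-F₂⁰ : ∀ (U : Subspace 0) → ¬ CyclicallyCovering U
no-covering-of-F₂⁰ U covering with covering []
... | _ , () , _

theorem2p1 : ∀ (m n hm hn hmn : ℕ) → IsH2 m hm → IsH2 n hn → IsH2 (m * n) hmn → hm + hn ≤ hmn
theorem2p1 zero     n        _ _ _ ((U , U-covering , _) , _) _ _ = ⊥-elim (no-covering-of-F₂⁰ U U-covering)
theorem2p1 (suc m′) zero     _ _ _ _ ((W , W-covering , _) , _) _ = ⊥-elim (no-covering-of-F₂⁰ W W-covering)
theorem2p1 (suc m′) (suc n′) hm hn hmn ((U , U-covering , U-codim) , _) ((W , W-covering , W-codim) , _) (_ , maximal)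
  with product-covering U W U-covering U-codim W-covering W-codim
... | S , S-covering , c , hm+hn≤c , S-codim = ≤-trans hm+hn≤c (maximal S c S-covering S-codim)
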